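{- Let $g:E_G\to Q$ be a uniformly random colouring of the edges of an $n\times n$ puzzle grid with $|Q|=q$. Let $e_1,\dots,e_m$ be pairwise disjoint pairs $e_i=\{h_i^1,h_i^2\}$ of distinct half-edges such that, for each $i$, $h_i^1$ and $h_i^2$ are not partners. Let $F\subseteq E_G$ be a set of edges whose colours are already known (i.e. we condition on any fixed values of $g$ on $F$), and assume that for every $i\in[m]$ at most one of $h_i^1,h_i^2$ belongs to an edge of $F$ (i.e. at most one of the colours of $h_i^1$ and $h_i^2$ is already known). Then $$\Pr[\text{all } e_1,\dots,e_m \text{ are monochromatic}\mid g|_F]\le\frac{1}{q^{\lceil m/2\rceil}}.$$
   Context: The grid $G$ consists of $n^2$ square pieces, each with four sides called half-edges. Two half-edges of pieces adjacent in $G$ that touch form an edge of $G$ and are called partners; a half-edge on the outer border of $G$ forms an edge by itself and has no partner. $E_G$ is the set of edges. The random colouring $g$ assigns each edge of $E_G$ an independent uniform colour from $Q$, and each half-edge gets the colour of the edge of $E_G$ containing it. A pair $e_i=\{h_i^1,h_i^2\}$ is monochromatic if $h_i^1$ and $h_i^2$ receive the same colour. (Such pairs arise as "new edges" of a rearrangement of the pieces: pairs of half-edges touching in the rearrangement that are not partners.) -}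

module Defs where

open import Data.Nat using (ℕ; zero; suc; _+_; _*_)
open import Data.Fin using (Fin; zero; suc; inject₁; join; combine)
open import Data.Fin.Properties using (_≟_)
open import Data.Fin.Subset using (Subset; _∈_)
open import Data.Fin.Subset.Properties using (_∈?_)
open import Data.Vec using (Vec; []; _∷_; lookup)
open import Data.List using (List; []; _∷_; map; concatMap; filter; length; allFin)
open import Data.List.Relation.Unary.All using (All)
open import Data.Product using (_×_; _,_; proj₁; proj₂)
open import Data.Sum using (_⊎_; inj₁; inj₂)
open import Relation.Nullary using (¬_; Dec; yes; no)
open import Relation.Nullary.Decidable using (_×-dec_; _→-dec_)
open import Relation.Binary.PropositionalEquality using (_≡_; _≢_)
open import Relation.Unary using (Decidable)

data Dir : Set where
  north east south west : Dir

-- A half-edge: a side of the piece in row i, column j (rows numbered top to bottom).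
HalfEdge : ℕ → Set
HalfEdge n = Fin n × Fin n × Dir

-- Edges of the n×n grid G:
--  inj₁ (i , c) : the vertical segment in row i at vertical grid line c (0..n)
--  inj₂ (r , j) : the horizontal segment in column j at horizontal grid line r (0..n)
Edge : ℕ → Set
Edge n = (Fin n × Fin (suc n)) ⊎ (Fin (suc n) × Fin n)

edgeOf : ∀ {n} → HalfEdge n → Edge n
edgeOf (i , j , west)  = inj₁ (i , inject₁ j)
edgeOf (i , j , east)  = inj₁ (i , suc j)
edgeOf (i , j , north) = inj₂ (inject₁ i , j)
edgeOf (i , j , south) = inj₂ (suc i , j)

numEdges : ℕ → ℕ
numEdges n = n * suc n + suc n * n

edgeIndex : ∀ {n} → Edge n → Fin (numEdges n)
edgeIndex {n} (inj₁ (i , c)) = join (n * suc n) (suc n * n) (inj₁ (combine i c))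
edgeIndex {n} (inj₂ (r , j)) = join (n * suc n) (suc n * n) (inj₂ (combine r j))

Partners : ∀ {n} → HalfEdge n → HalfEdge n → Set
Partners h h' = h ≢ h' × edgeOf h ≡ edgeOf h'

-- A colouring g : E_G → Q with Q = Fin q, represented as a vector indexed by edge indices.
Colouring : ℕ → ℕ → Set
Colouring n q = Vec (Fin q) (numEdges n)

colourOf : ∀ {n q} → Colouring n q → HalfEdge n → Fin q
colourOf g h = lookup g (edgeIndex (edgeOf h))

allVecs : ∀ q k → List (Vec (Fin q) k)
allVecs q zero = [] ∷ []
allVecs q (suc k) = concatMap (λ c → map (c ∷_) (allVecs q k)) (allFin q)

AgreesOn : ∀ {N q} → Subset N → Vec (Fin q) N → Vec (Fin q) N → Set
AgreesOn {N} F f₀ g = All (λ e → e ∈ F → lookup g e ≡ lookup f₀ e) (allFin N)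

agreesOn? : ∀ {N q} (F : Subset N) (f₀ : Vec (Fin q) N) → Decidable (AgreesOn F f₀)
agreesOn? {N} F f₀ g = Data.List.Relation.Unary.All.all? (λ e → (e ∈? F) →-dec (lookup g e ≟ lookup f₀ e)) (allFin N)

Monochromatic : ∀ {n q} → Colouring n q → HalfEdge n × HalfEdge n → Set
Monochromatic g (h₁ , h₂) = colourOf g h₁ ≡ colourOf g h₂

AllMono : ∀ {n q m} → (Fin m → HalfEdge n × HalfEdge n) → Colouring n q → Set
AllMono {m = m} e g = All (λ i → Monochromatic g (e i)) (allFin m)

allMono? : ∀ {n q m} (e : Fin m → HalfEdge n × HalfEdge n) → Decidable (AllMono {q = q} e)
allMono? {m = m} e g = Data.List.Relation.Unary.All.all? (λ i → colourOf g (proj₁ (e i)) ≟ colourOf g (proj₂ (e i))) (allFin m)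

-- Number of colourings agreeing with f₀ on F (all outcomes of the conditioned experiment).
countAgree : ∀ n q → Subset (numEdges n) → Colouring n q → ℕ
countAgree n q F f₀ = length (filter (agreesOn? F f₀) (allVecs q (numEdges n)))

countGood : ∀ n q {m} → (Fin m → HalfEdge n × HalfEdge n) → Subset (numEdges n) → Colouring n q → ℕ
countGood n q e F f₀ =
  length (filter (allMono? e) (filter (agreesOn? F f₀) (allVecs q (numEdges n))))

InF : ∀ {n} → Subset (numEdges n) → HalfEdge n → Set
InF F h = edgeIndex (edgeOf h) ∈ F

-- Take the first pair {h, h′} and an end whose edge x lies outside F, say h. Given the colours of
-- all other edges, g(x) is uniform, so {h, h′} is monochromatic with conditional probability 1/q.
-- Besides h, the edge x carries at most one half-edge, so at most one other pair involves x;
-- dropping it leaves pairs whose colours ignore x, and induction on these at least m − 2 pairs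
-- gives the factor q^⌈m/2⌉.

module Submission where

open import Defs
open import Data.Bool using (Bool; true; false; if_then_else_)
open import Data.Bool.Properties using (¬-not)
open import Data.Fin using (Fin; zero; suc; join; splitAt)
open import Data.Fin.Properties using (_≟_; inject₁-injective; suc-injective; splitAt-join; combine-injective)
open import Data.Fin.Subset using (Subset; _∈_; _∉_)
open import Data.Fin.Subset.Properties using (_∈?_)
open import Data.List using (List; []; _∷_; _++_; map; concatMap; filter; length; tabulate; allFin)
open import Data.List.Properties
  using (filter-≐; filter-++; length-++; filter-all; length-filter; length-map; length-tabulate)
open import Data.List.Relation.Binary.Sublist.Propositional using (⊆-refl)
import Data.List.Relation.Binary.Sublist.Propositional.Properties as Sublist
open import Data.List.Relation.Unary.All as All using (All; []; _∷_; all?)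
import Data.List.Relation.Unary.All.Properties as All
open import Data.List.Relation.Unary.AllPairs using (AllPairs; []; _∷_)
import Data.List.Relation.Unary.AllPairs.Properties as AllPairs
open import Data.Nat using (ℕ; zero; suc; _+_; _*_; _^_; _≤_; _<_; z≤n; s≤s; ⌈_/2⌉)
open import Data.Nat.Induction using (<-wellFounded)
open import Data.Nat.Properties
  using (+-*-semiring; *-comm; *-assoc; *-identityʳ; *-mono-≤; *-monoʳ-≤; ^-monoʳ-≤; ⌊n/2⌋-mono; ≤-reflexive;
         module ≤-Reasoning)
open import Data.Product using (_×_; _,_; proj₁; proj₂)
open import Data.Product.Properties using (,-injective)
open import Data.Sum using (_⊎_; inj₁; inj₂)
open import Data.Sum.Properties using (inj₁-injective; inj₂-injective)
open import Data.Vec using (Vec; _∷_; lookup; _[_]≔_)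
open import Data.Vec.Properties using (lookup∘update′)
open import Function using (_∘_; id)
open import Induction.WellFounded using (Acc; acc)
open import Relation.Nullary using (¬_; Dec; does; yes; no; _⊎-dec_)
open import Relation.Unary using (Pred; Decidable; _⊆_; _≐_; _∩_)
open import Relation.Unary.Properties using (_∩?_; ∁?)
open import Relation.Binary.PropositionalEquality
open import Algebra.Properties.Semiring.Sum +-*-semiring
  using (sum-syntax; sum-cong-≗; ∑-distrib-+; *-distribʳ-sum; sum-replicate-zero)

count : ∀ {a p} {A : Set a} {P : Pred A p} → Decidable P → List A → ℕ
count P? xs = length (filter P? xs)

indicator : ∀ {p} {P : Set p} → Dec P → ℕ
indicator P? = if does P? then 1 else 0

module _ {a p} {A : Set a} {P : Pred A p} (P? : Decidable P) where

  count-∷ : ∀ x xs → count P? (x ∷ xs) ≡ indicator (P? x) + count P? xs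
  count-∷ x xs with does (P? x)
  ... | true  = refl
  ... | false = refl

  count-++ : ∀ xs ys → count P? (xs ++ ys) ≡ count P? xs + count P? ys
  count-++ xs ys = trans (cong length (filter-++ P? xs ys)) (length-++ (filter P? xs))

  count-map : ∀ {b} {B : Set b} (f : B → A) xs → count P? (map f xs) ≡ count (P? ∘ f) xs
  count-map f [] = refl
  count-map f (x ∷ xs) with does (P? (f x))
  ... | true  = cong suc (count-map f xs)
  ... | false = count-map f xs

  count-≐ : ∀ {r} {R : Pred A r} (R? : Decidable R) → P ≐ R → ∀ xs → count P? xs ≡ count R? xs
  count-≐ R? P≐R xs = cong length (filter-≐ P? R? P≐R xs)

  count-mono : ∀ {r} {R : Pred A r} (R? : Decidable R) → P ⊆ R → ∀ xs → count P? xs ≤ count R? xs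
  count-mono R? P⊆R xs = Sublist.length-mono-≤ (Sublist.filter⁺ P? R? (λ { refl → P⊆R }) (⊆-refl {x = xs}))

  count-filter : ∀ {r} {R : Pred A r} (R? : Decidable R) xs → count R? (filter P? xs) ≡ count (P? ∩? R?) xs
  count-filter R? [] = refl
  count-filter R? (x ∷ xs) with does (P? x)
  ... | false = count-filter R? xs
  ... | true with does (R? x)
  ...   | true  = cong suc (count-filter R? xs)
  ...   | false = count-filter R? xs

  count-concatMap-tabulate : ∀ {b} {B : Set b} {n} (f : B → List A) (g : Fin n → B) →
    count P? (concatMap f (tabulate g)) ≡ ∑[ i < n ] count P? (f (g i))
  count-concatMap-tabulate {n = zero}  f g = refl
  count-concatMap-tabulate {n = suc n} f g =
    trans (count-++ (f (g zero)) _) (cong (count P? (f (g zero)) +_) (count-concatMap-tabulate f (g ∘ suc)))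

  length≤suc-count∁ : ∀ {xs} → AllPairs (λ x y → P x → ¬ P y) xs → length xs ≤ suc (count (∁? P?) xs)
  length≤suc-count∁ [] = z≤n
  length≤suc-count∁ {x ∷ xs} (¬Ps ∷ pairs) with P? x
  ... | yes Px = s≤s (≤-reflexive (sym (cong length (filter-all (∁? P?) (All.map (λ ¬Py → ¬Py Px) ¬Ps)))))
  ... | no  _  = s≤s (length≤suc-count∁ pairs)

∑-const : ∀ n a → ∑[ i < n ] a ≡ n * a
∑-const zero    a = refl
∑-const (suc n) a = cong (a +_) (∑-const n a)

∑-indicator-≟ : ∀ {q} (a : Fin q) → ∑[ c < q ] indicator (c ≟ a) ≡ 1
∑-indicator-≟ {suc q} zero    = cong suc (sum-replicate-zero q)
∑-indicator-≟ {suc q} (suc a) = ∑-indicator-≟ a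

module _ {a p q} {A : Set a} {P : Pred A p} (P? : Decidable P) (t : A → Fin q) where

  ∑-indicator-fibre : ∀ x → ∑[ c < q ] indicator ((P? ∩? λ y → c ≟ t y) x) ≡ indicator (P? x)
  ∑-indicator-fibre x with does (P? x)
  ... | true  = ∑-indicator-≟ (t x)
  ... | false = sum-replicate-zero q

  ∑-count-fibres : ∀ xs → ∑[ c < q ] count (P? ∩? λ y → c ≟ t y) xs ≡ count P? xs
  ∑-count-fibres [] = sum-replicate-zero q
  ∑-count-fibres (x ∷ xs) = begin
    ∑[ c < q ] count (Fibre c) (x ∷ xs)
      ≡⟨ sum-cong-≗ (λ c → count-∷ (Fibre c) x xs) ⟩
    ∑[ c < q ] (indicator (Fibre c x) + count (Fibre c) xs)
      ≡⟨ ∑-distrib-+ (indicator ∘ (λ c → Fibre c x)) (λ c → count (Fibre c) xs) ⟩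
    ∑[ c < q ] indicator (Fibre c x) + ∑[ c < q ] count (Fibre c) xs
      ≡⟨ cong₂ _+_ (∑-indicator-fibre x) (∑-count-fibres xs) ⟩
    indicator (P? x) + count P? xs
      ≡⟨ count-∷ P? x xs ⟨
    count P? (x ∷ xs) ∎
    where
    open ≡-Reasoning
    Fibre : (c : Fin q) → Decidable (P ∩ λ y → c ≡ t y)
    Fibre c = P? ∩? λ y → c ≟ t y

count-allVecs-suc : ∀ {q k p} {P : Pred (Vec (Fin q) (suc k)) p} (P? : Decidable P) →
  count P? (allVecs q (suc k)) ≡ ∑[ c < q ] count (P? ∘ (c ∷_)) (allVecs q k)
count-allVecs-suc {q} {k} P? =
  trans (count-concatMap-tabulate P? (λ c → map (c ∷_) (allVecs q k)) id)
        (sum-cong-≗ (λ c → count-map P? (c ∷_) (allVecs q k)))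

count-lookup≡ : ∀ {q N r} (x : Fin N) {R : Pred (Vec (Fin q) N) r} (R? : Decidable R) (t : Vec (Fin q) N → Fin q) →
  (∀ g c → R g → R (g [ x ]≔ c)) → (∀ g c → t (g [ x ]≔ c) ≡ t g) →
  count (R? ∩? λ g → lookup g x ≟ t g) (allVecs q N) * q ≡ count R? (allVecs q N)
count-lookup≡ {zero} {suc k} zero R? t R-free t-free = refl
count-lookup≡ {suc q} {suc k} zero {R} R? t R-free t-free = begin
  count (R? ∩? E?) (allVecs (suc q) (suc k)) * suc q
    ≡⟨ cong (_* suc q) (count-allVecs-suc (R? ∩? E?)) ⟩
  (∑[ c < suc q ] count ((R? ∩? E?) ∘ (c ∷_)) V) * suc q
    ≡⟨ cong (_* suc q) (sum-cong-≗ (λ c → count-≐ ((R? ∩? E?) ∘ (c ∷_)) (R₀? ∩? λ v → c ≟ t₀ v) (fibre≐ c) V)) ⟩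
  (∑[ c < suc q ] count (R₀? ∩? λ v → c ≟ t₀ v) V) * suc q
    ≡⟨ cong (_* suc q) (∑-count-fibres R₀? t₀ V) ⟩
  count R₀? V * suc q
    ≡⟨ *-comm (count R₀? V) (suc q) ⟩
  suc q * count R₀? V
    ≡⟨ ∑-const (suc q) (count R₀? V) ⟨
  ∑[ c < suc q ] count R₀? V
    ≡⟨ sum-cong-≗ (λ c → count-≐ R₀? (R? ∘ (c ∷_)) (R₀≐ c) V) ⟩
  ∑[ c < suc q ] count (R? ∘ (c ∷_)) V
    ≡⟨ count-allVecs-suc R? ⟨
  count R? (allVecs (suc q) (suc k)) ∎
  where
  open ≡-Reasoning
  V : List (Vec (Fin (suc q)) k)
  V = allVecs (suc q) k
  E? : Decidable (λ g → lookup g zero ≡ t g)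
  E? g = lookup g zero ≟ t g
  R₀? : Decidable (R ∘ (zero ∷_))
  R₀? = R? ∘ (zero ∷_)
  t₀ : Vec (Fin (suc q)) k → Fin (suc q)
  t₀ = t ∘ (zero ∷_)
  R₀≐ : ∀ c → R ∘ (zero ∷_) ≐ R ∘ (c ∷_)
  R₀≐ c = (λ {v} → R-free (zero ∷ v) c) , (λ {v} → R-free (c ∷ v) zero)
  fibre≐ : ∀ c → (λ v → R (c ∷ v) × c ≡ t (c ∷ v)) ≐ (λ v → R (zero ∷ v) × c ≡ t₀ v)
  fibre≐ c = (λ {v} (r , e) → proj₂ (R₀≐ c) r , trans e (sym (t-free (c ∷ v) zero)))
           , (λ {v} (r , e) → proj₁ (R₀≐ c) r , trans e (sym (t-free (zero ∷ v) c)))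
count-lookup≡ {q} {suc k} (suc x) {R} R? t R-free t-free = begin
  count (R? ∩? E?) (allVecs q (suc k)) * q
    ≡⟨ cong (_* q) (count-allVecs-suc (R? ∩? E?)) ⟩
  (∑[ c < q ] count ((R? ∩? E?) ∘ (c ∷_)) V) * q
    ≡⟨ *-distribʳ-sum q (λ c → count ((R? ∩? E?) ∘ (c ∷_)) V) ⟩
  ∑[ c < q ] (count ((R? ∩? E?) ∘ (c ∷_)) V * q)
    ≡⟨ sum-cong-≗ (λ c → count-lookup≡ x (R? ∘ (c ∷_)) (t ∘ (c ∷_)) (R-free ∘ (c ∷_)) (t-free ∘ (c ∷_))) ⟩
  ∑[ c < q ] count (R? ∘ (c ∷_)) V
    ≡⟨ count-allVecs-suc R? ⟨
  count R? (allVecs q (suc k)) ∎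
  where
  open ≡-Reasoning
  V : List (Vec (Fin q) k)
  V = allVecs q k
  E? : Decidable (λ g → lookup g (suc x) ≡ t g)
  E? g = lookup g (suc x) ≟ t g

^⌈suc/2⌉≤*^⌈/2⌉ : ∀ q {a b} → a ≤ suc b → q ^ ⌈ suc a /2⌉ ≤ q * q ^ ⌈ b /2⌉
^⌈suc/2⌉≤*^⌈/2⌉ zero    a≤1+b = z≤n
^⌈suc/2⌉≤*^⌈/2⌉ (suc q) a≤1+b = *-monoʳ-≤ (suc q) (^-monoʳ-≤ (suc q) (⌊n/2⌋-mono a≤1+b))

module MonochromaticPairs
  {H : Set} {N q : ℕ} (E : H → Fin N)
  (partner-unique : ∀ {h k k′} → h ≢ k × E h ≡ E k → h ≢ k′ × E h ≡ E k′ → k ≡ k′)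
  (F : Subset N)
  {r} {R : Pred (Vec (Fin q) N) r} (R? : Decidable R)
  (R-free : ∀ {x} → x ∉ F → ∀ g c → R g → R (g [ x ]≔ c))
  where

  Pair : Set
  Pair = H × H

  SameColour : Vec (Fin q) N → Pair → Set
  SameColour g p = lookup g (E (proj₁ p)) ≡ lookup g (E (proj₂ p))

  AllSameColour : List Pair → Vec (Fin q) N → Set
  AllSameColour ps g = All (SameColour g) ps

  allSameColour? : ∀ ps → Decidable (AllSameColour ps)
  allSameColour? ps g = all? (λ p → lookup g (E (proj₁ p)) ≟ lookup g (E (proj₂ p))) ps

  Touches : Fin N → Pair → Set
  Touches x p = E (proj₁ p) ≡ x ⊎ E (proj₂ p) ≡ x

  touches? : ∀ x → Decidable (Touches x)
  touches? x p = (E (proj₁ p) ≟ x) ⊎-dec (E (proj₂ p) ≟ x)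

  avoiding : Fin N → List Pair → List Pair
  avoiding x = filter (∁? (touches? x))

  Disjoint : Pair → Pair → Set
  Disjoint p p′ = proj₁ p ≢ proj₁ p′ × proj₁ p ≢ proj₂ p′ × proj₂ p ≢ proj₁ p′ × proj₂ p ≢ proj₂ p′

  Admissible : Pair → Set
  Admissible p = E (proj₁ p) ≢ E (proj₂ p) × ¬ (E (proj₁ p) ∈ F × E (proj₂ p) ∈ F)

  Bound : List Pair → Set
  Bound ps = count (R? ∩? allSameColour? ps) (allVecs q N) * q ^ ⌈ length ps /2⌉ ≤ count R? (allVecs q N)

  sameColour-update : ∀ {x p} g c → ¬ Touches x p → SameColour g p → SameColour (g [ x ]≔ c) p
  sameColour-update g c ¬touch same =
    trans (lookup∘update′ (¬touch ∘ inj₁) g c) (trans same (sym (lookup∘update′ (¬touch ∘ inj₂) g c)))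

  touches-unique : ∀ {h h′ p p′} → Disjoint (h , h′) p → Disjoint (h , h′) p′ → Disjoint p p′ →
                   Touches (E h) p → ¬ Touches (E h) p′
  touches-unique (h≢p₁ , h≢p₂ , _) (h≢p′₁ , h≢p′₂ , _) (d₁₁ , d₁₂ , d₂₁ , d₂₂) = λ where
    (inj₁ e) (inj₁ e′) → d₁₁ (partner-unique (h≢p₁ , sym e) (h≢p′₁ , sym e′))
    (inj₁ e) (inj₂ e′) → d₁₂ (partner-unique (h≢p₁ , sym e) (h≢p′₂ , sym e′))
    (inj₂ e) (inj₁ e′) → d₂₁ (partner-unique (h≢p₂ , sym e) (h≢p′₁ , sym e′))
    (inj₂ e) (inj₂ e′) → d₂₂ (partner-unique (h≢p₂ , sym e) (h≢p′₂ , sym e′))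

  touching-at-most-once : ∀ {h h′ rest} → All (Disjoint (h , h′)) rest → AllPairs Disjoint rest →
                          AllPairs (λ p p′ → Touches (E h) p → ¬ Touches (E h) p′) rest
  touching-at-most-once []       []           = []
  touching-at-most-once (d ∷ ds) (d′s ∷ dds) =
    All.zipWith (λ (d′ , d″) → touches-unique d d′ d″) (ds , d′s) ∷ touching-at-most-once ds dds

  bound-cons : ∀ {h h′ rest} → E h ∉ F → E h ≢ E h′ → All (Disjoint (h , h′)) rest → AllPairs Disjoint rest →
               Bound (avoiding (E h) rest) → Bound ((h , h′) ∷ rest)
  bound-cons {h} {h′} {rest} x∉F x≢y ds dds ih = begin
    count (R? ∩? allSameColour? ((h , h′) ∷ rest)) 𝒞 * q ^ ⌈ suc (length rest) /2⌉
      ≤⟨ *-mono-≤ (count-mono (R? ∩? allSameColour? ((h , h′) ∷ rest)) (R′? ∩? E?) narrow 𝒞)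
                  (^⌈suc/2⌉≤*^⌈/2⌉ q (length≤suc-count∁ (touches? x) (touching-at-most-once ds dds))) ⟩
    count (R′? ∩? E?) 𝒞 * (q * q ^ ⌈ length rest′ /2⌉)
      ≡⟨ *-assoc (count (R′? ∩? E?) 𝒞) q _ ⟨
    count (R′? ∩? E?) 𝒞 * q * q ^ ⌈ length rest′ /2⌉
      ≡⟨ cong (_* q ^ ⌈ length rest′ /2⌉) (count-lookup≡ x R′? (λ g → lookup g (E h′)) R′-free
                                            (λ g c → lookup∘update′ (x≢y ∘ sym) g c)) ⟩
    count R′? 𝒞 * q ^ ⌈ length rest′ /2⌉
      ≤⟨ ih ⟩
    count R? 𝒞 ∎
    where
    open ≤-Reasoning
    x : Fin N
    x = E h
    𝒞 : List (Vec (Fin q) N)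
    𝒞 = allVecs q N
    rest′ : List Pair
    rest′ = avoiding x rest
    R′? : Decidable (R ∩ AllSameColour rest′)
    R′? = R? ∩? allSameColour? rest′
    E? : Decidable (λ g → lookup g x ≡ lookup g (E h′))
    E? g = lookup g x ≟ lookup g (E h′)
    narrow : R ∩ AllSameColour ((h , h′) ∷ rest) ⊆ (R ∩ AllSameColour rest′) ∩ (λ g → lookup g x ≡ lookup g (E h′))
    narrow (r , same ∷ sames) = (r , All.filter⁺ (∁? (touches? x)) sames) , same
    R′-free : ∀ g c → (R ∩ AllSameColour rest′) g → (R ∩ AllSameColour rest′) (g [ x ]≔ c)
    R′-free g c (r , sames) =
      R-free x∉F g c r , All.zipWith (λ (¬touch , same) → sameColour-update g c ¬touch same)
                                     (All.all-filter (∁? (touches? x)) rest , sames)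

  bound-swap : ∀ {h h′ rest} → Bound ((h′ , h) ∷ rest) → Bound ((h , h′) ∷ rest)
  bound-swap {h} {h′} {rest} =
    subst (λ c → c * q ^ ⌈ suc (length rest) /2⌉ ≤ count R? (allVecs q N))
          (count-≐ (R? ∩? allSameColour? ((h′ , h) ∷ rest)) (R? ∩? allSameColour? ((h , h′) ∷ rest))
                   (flip , flip) (allVecs q N))
    where
    flip : ∀ {a b rest g} → (R ∩ AllSameColour ((a , b) ∷ rest)) g → (R ∩ AllSameColour ((b , a) ∷ rest)) g
    flip (r , same ∷ sames) = r , sym same ∷ sames

  bound : ∀ ps → Acc _<_ (length ps) → All Admissible ps → AllPairs Disjoint ps → Bound ps
  bound [] _ [] [] =
    ≤-reflexive (trans (*-identityʳ _) (count-≐ (R? ∩? allSameColour? []) R? (proj₁ , (_, [])) (allVecs q N)))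
  bound ((h , h′) ∷ rest) (acc rs) ((x≢y , ¬both) ∷ adms) (ds ∷ dds) = by-free-end (E h ∈? F)
    where
    recurse : ∀ x → Bound (avoiding x rest)
    recurse x = bound (avoiding x rest) (rs (s≤s (length-filter (∁? (touches? x)) rest)))
                      (All.filter⁺ (∁? (touches? x)) adms) (AllPairs.filter⁺ (∁? (touches? x)) dds)
    disjoint-swap : ∀ {p} → Disjoint (h , h′) p → Disjoint (h′ , h) p
    disjoint-swap (a , b , c , d) = c , d , a , b
    by-free-end : Dec (E h ∈ F) → Bound ((h , h′) ∷ rest)
    by-free-end (no  x∉F) = bound-cons x∉F x≢y ds dds (recurse (E h))
    by-free-end (yes x∈F) =
      bound-swap (bound-cons (¬both ∘ (x∈F ,_)) (x≢y ∘ sym) (All.map disjoint-swap ds) dds (recurse (E h′)))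

join-injective : ∀ m n {i j : Fin m ⊎ Fin n} → join m n i ≡ join m n j → i ≡ j
join-injective m n {i} {j} eq = trans (sym (splitAt-join m n i)) (trans (cong (splitAt m) eq) (splitAt-join m n j))

edgeIndex-injective : ∀ {n} {a b : Edge n} → edgeIndex a ≡ edgeIndex b → a ≡ b
edgeIndex-injective {n} {inj₁ (i , c)} {inj₁ (i′ , c′)} eq
  with refl , refl ← combine-injective i c i′ c′ (inj₁-injective (join-injective (n * suc n) (suc n * n) eq)) = refl
edgeIndex-injective {n} {inj₂ (r , j)} {inj₂ (r′ , j′)} eq
  with refl , refl ← combine-injective r j r′ j′ (inj₂-injective (join-injective (n * suc n) (suc n * n) eq)) = refl
edgeIndex-injective {n} {inj₁ _} {inj₂ _} eq with () ← join-injective (n * suc n) (suc n * n) {inj₁ _} {inj₂ _} eq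
edgeIndex-injective {n} {inj₂ _} {inj₁ _} eq with () ← join-injective (n * suc n) (suc n * n) {inj₂ _} {inj₁ _} eq

-- Every edge is the west or north side of at most one piece, and the east or south side of at most one.
side : ∀ {n} → HalfEdge n → Bool
side (_ , _ , north) = true
side (_ , _ , west)  = true
side (_ , _ , south) = false
side (_ , _ , east)  = false

edgeOf-side-injective : ∀ {n} (h h′ : HalfEdge n) → edgeOf h ≡ edgeOf h′ → side h ≡ side h′ → h ≡ h′
edgeOf-side-injective (i , j , north) (i′ , j′ , north) e _
  with i≡ , refl ← ,-injective (inj₂-injective e) = cong (_, j , north) (inject₁-injective i≡)
edgeOf-side-injective (i , j , south) (i′ , j′ , south) e _
  with i≡ , refl ← ,-injective (inj₂-injective e) = cong (_, j , south) (suc-injective i≡)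
edgeOf-side-injective (i , j , west) (i′ , j′ , west) e _
  with refl , j≡ ← ,-injective (inj₁-injective e) = cong (λ j → i , j , west) (inject₁-injective j≡)
edgeOf-side-injective (i , j , east) (i′ , j′ , east) e _
  with refl , j≡ ← ,-injective (inj₁-injective e) = cong (λ j → i , j , east) (suc-injective j≡)
edgeOf-side-injective (_ , _ , north) (_ , _ , south) _ ()
edgeOf-side-injective (_ , _ , north) (_ , _ , east)  () _
edgeOf-side-injective (_ , _ , north) (_ , _ , west)  () _
edgeOf-side-injective (_ , _ , south) (_ , _ , north) _ ()
edgeOf-side-injective (_ , _ , south) (_ , _ , east)  () _
edgeOf-side-injective (_ , _ , south) (_ , _ , west)  () _
edgeOf-side-injective (_ , _ , west)  (_ , _ , north) () _
edgeOf-side-injective (_ , _ , west)  (_ , _ , south) () _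
edgeOf-side-injective (_ , _ , west)  (_ , _ , east)  _ ()
edgeOf-side-injective (_ , _ , east)  (_ , _ , north) () _
edgeOf-side-injective (_ , _ , east)  (_ , _ , south) () _
edgeOf-side-injective (_ , _ , east)  (_ , _ , west)  _ ()

partner-unique : ∀ {n} {h k k′ : HalfEdge n} → Partners h k → Partners h k′ → k ≡ k′
partner-unique {h = h} {k} {k′} (h≢k , e) (h≢k′ , e′) =
  edgeOf-side-injective k k′ (trans (sym e) e′)
    (trans (¬-not (other-side h≢k e)) (sym (¬-not (other-side h≢k′ e′))))
  where
  other-side : ∀ {l} → h ≢ l → edgeOf h ≡ edgeOf l → side l ≢ side h
  other-side h≢l e s = h≢l (edgeOf-side-injective h _ e (sym s))

agreesOn-free : ∀ {N q} (F : Subset N) (f₀ : Vec (Fin q) N) {x} → x ∉ F →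
                ∀ g c → AgreesOn F f₀ g → AgreesOn F f₀ (g [ x ]≔ c)
agreesOn-free F f₀ x∉F g c = All.map (λ agree e∈F → trans (lookup∘update′ (λ { refl → x∉F e∈F }) g c) (agree e∈F))

proposition2 : (n q m : ℕ) (e : Fin m → HalfEdge n × HalfEdge n)
    → (∀ i → proj₁ (e i) ≢ proj₂ (e i))
    → (∀ i → ¬ Partners (proj₁ (e i)) (proj₂ (e i)))
    → (∀ i j → i ≢ j →
         proj₁ (e i) ≢ proj₁ (e j) × proj₁ (e i) ≢ proj₂ (e j)
         × proj₂ (e i) ≢ proj₁ (e j) × proj₂ (e i) ≢ proj₂ (e j))
    → (F : Subset (numEdges n))
    → (∀ i → ¬ (InF F (proj₁ (e i)) × InF F (proj₂ (e i))))
    → (f₀ : Colouring n q)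
    → countGood n q e F f₀ * q ^ ⌈ m /2⌉ ≤ countAgree n q F f₀
proposition2 n q m e distinct non-partners disjoint F not-both-known f₀ = begin
  countGood n q e F f₀ * q ^ ⌈ m /2⌉
    ≡⟨ cong₂ (λ c k → c * q ^ ⌈ k /2⌉) countGood≡ (sym length-ps) ⟩
  count (agree? ∩? allSameColour? ps) 𝒞 * q ^ ⌈ length ps /2⌉
    ≤⟨ bound ps (<-wellFounded _) admissible disjoint-pairs ⟩
  countAgree n q F f₀ ∎
  where
  open ≤-Reasoning
  𝒞 : List (Colouring n q)
  𝒞 = allVecs q (numEdges n)
  agree? : Decidable (AgreesOn F f₀)
  agree? = agreesOn? F f₀
  open MonochromaticPairs (λ (h : HalfEdge n) → edgeIndex (edgeOf h))
         (λ (h≢k , same) (h≢k′ , same′) → partner-unique (h≢k , edgeIndex-injective same) (h≢k′ , edgeIndex-injective same′))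
         F agree? (agreesOn-free F f₀)
  ps : List Pair
  ps = map e (allFin m)
  length-ps : length ps ≡ m
  length-ps = trans (length-map e (allFin m)) (length-tabulate {n = m} id)
  countGood≡ : countGood n q e F f₀ ≡ count (agree? ∩? allSameColour? ps) 𝒞
  countGood≡ = trans (count-filter agree? (allMono? e) 𝒞)
                     (count-≐ (agree? ∩? allMono? e) (agree? ∩? allSameColour? ps)
                              ((λ (a , s) → a , All.map⁺ s) , (λ (a , s) → a , All.map⁻ s)) 𝒞)
  admissible : All Admissible ps
  admissible = All.map⁺ (All.tabulate⁺ λ i →
    (λ same → non-partners i (distinct i , edgeIndex-injective same)) , not-both-known i)
  disjoint-pairs : AllPairs Disjoint ps
  disjoint-pairs = AllPairs.map⁺ (AllPairs.tabulate⁺ (disjoint _ _))
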